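{- Let $S$ be a string of length $n>1$ as described in the context and let $\mathcal{G}_1,\dots,\mathcal{G}_m$ be a Lyndon grouping for $S$. Then for every $i\in\{0,\dots,n\}$, the elements of $\mathcal{P}_i$ lie in pairwise different groups of this grouping.
   Context: $S$ is a string of length $n>1$ over a totally ordered alphabet $\Sigma$, zero-indexed, with $S[n-1]=\$$ and $S[k]>\$$ for all $k<n-1$. $S_i=S[i]\cdots S[n-1]$ is the suffix at $i$ ($S_n$ empty); strings are compared lexicographically ($\prec$), a proper prefix being smaller. A non-empty string is a Lyndon word if it is lexicographically smaller than all its proper suffixes; $\mathcal{L}_i$ is the longest prefix of $S_i$ that is a Lyndon word. $\mathrm{nss}[i]=\min\{j\in\{i+1,\dots,n\}:S_j\prec S_i\}$ and $\mathcal{P}_i=\{j\in\{0,\dots,i-1\}:\mathrm{nss}[j]=i\}$. The suffix array $\mathrm{SA}$ is the permutation of $\{0,\dots,n-1\}$ with $S_{\mathrm{SA}[0]}\prec\cdots\prec S_{\mathrm{SA}[n-1]}$. A group with context $\alpha$ is a triple $\langle g_s,g_e,|\alpha|\rangle$ with $0\le g_s\le g_e<n$ such that $\alpha$ is a Lyndon word and every $i\in\{\mathrm{SA}[g_s],\dots,\mathrm{SA}[g_e]\}$ satisfies $S_i=\alpha S_{i+|\alpha|}$; its elements are $\mathrm{SA}[g_s],\dots,\mathrm{SA}[g_e]$. A suffix grouping is a set of groups $\mathcal{G}_j=\langle g_{s,j},g_{e,j},|\alpha_j|\rangle$, $j=1,\dots,m$, with $g_{s,1}=0$, $g_{e,m}=n-1$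 and $g_{s,j}=g_{e,j-1}+1$ for $2\le j\le m$. A group is Lyndon if all its elements $i$ have $\mathcal{L}_i=\alpha$ (its context); a suffix grouping is Lyndon if all its groups are Lyndon. -}

module Defs where

open import Data.Nat using (ℕ; zero; suc; _+_; _∸_; _≤_; _<_)
open import Data.List using (List; []; _∷_; _++_; length; drop; take)
open import Data.Product using (Σ; _×_; _,_; ∃; ∃-syntax)
open import Relation.Binary.PropositionalEquality using (_≡_)
open import Relation.Nullary using (¬_)

module Strings {A : Set} (_⊏_ : A → A → Set) where

  data _≺_ : List A → List A → Set where
    []≺∷ : ∀ {y ys} → [] ≺ (y ∷ ys)
    head≺ : ∀ {x y xs ys} → x ⊏ y → (x ∷ xs) ≺ (y ∷ ys)
    tail≺ : ∀ {x xs ys} → xs ≺ ys → (x ∷ xs) ≺ (x ∷ ys)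

  IsLyndon : List A → Set
  IsLyndon w = 0 < length w × (∀ k → 0 < k → k < length w → w ≺ drop k w)

  IsLongestLyndonPrefix : List A → List A → Set
  IsLongestLyndonPrefix α s =
    length α ≤ length s × take (length α) s ≡ α × IsLyndon α ×
    (∀ k → length α < k → k ≤ length s → ¬ IsLyndon (take k s))

  module OnString (S : List A) where

    n : ℕ
    n = length S

    Suf : ℕ → List A
    Suf i = drop i S

    Nss : ℕ → ℕ → Set
    Nss i j = i < j × j ≤ n × Suf j ≺ Suf i ×
              (∀ k → i < k → k < j → ¬ (Suf k ≺ Suf i))

    -- j ∈ P_i
    InP : ℕ → ℕ → Set
    InP i j = j < i × Nss j i

    IsSuffixArray : (ℕ → ℕ) → Set
    IsSuffixArray SA =
      (∀ k → k < n → SA k < n) ×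
      (∀ i → i < n → ∃[ k ] (k < n × SA k ≡ i)) ×
      (∀ a b → a < b → b < n → Suf (SA a) ≺ Suf (SA b))

    -- a group ⟨ gs , ge , |α| ⟩ with context α (α recorded explicitly)
    record Group : Set where
      constructor ⟨_,_,_⟩
      field
        gs : ℕ
        ge : ℕ
        ctx : List A

    open Group public

    module WithSA (SA : ℕ → ℕ) where

      ElemOf : ℕ → Group → Set
      ElemOf i g = ∃[ k ] (gs g ≤ k × k ≤ ge g × SA k ≡ i)

      IsGroup : Group → Set
      IsGroup g = gs g ≤ ge g × ge g < n × IsLyndon (ctx g) ×
                  (∀ i → ElemOf i g → Suf i ≡ ctx g ++ Suf (i + length (ctx g)))

      IsLyndonGroup : Group → Set
      IsLyndonGroup g = IsGroup g × (∀ i → ElemOf i g → IsLongestLyndonPrefix (ctx g) (Suf i))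

      -- groups G 1 , … , G m (indices 1..m as in the paper)
      IsSuffixGrouping : ℕ → (ℕ → Group) → Set
      IsSuffixGrouping m G =
        1 ≤ m ×
        (∀ j → 1 ≤ j → j ≤ m → IsGroup (G j)) ×
        gs (G 1) ≡ 0 × ge (G m) ≡ n ∸ 1 ×
        (∀ j → 2 ≤ j → j ≤ m → gs (G j) ≡ suc (ge (G (j ∸ 1))))

      IsLyndonGrouping : ℕ → (ℕ → Group) → Set
      IsLyndonGrouping m G =
        IsSuffixGrouping m G × (∀ j → 1 ≤ j → j ≤ m → IsLyndonGroup (G j))

{-# OPTIONS --safe #-}
-- Suppose j < j′ both have nss = i and share a Lyndon group with context α. As α is a Lyndon
-- prefix of S_j′, a suffix starting strictly inside α cannot be smaller than S_j′, so
-- j′ + |α| ≤ i. On the other hand S[j..i) is a Lyndon word because i = nss[j], and it is longer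
-- than α since j + |α| < j′ + |α| ≤ i; this contradicts α being the longest Lyndon prefix of S_j.
module Submission where

open import Defs
open import Data.Nat using (ℕ; zero; suc; _+_; _≤_; _<_; s≤s; _≤?_)
open import Data.Nat.Properties
open import Data.List using (List; []; _∷_; _++_; length; take; drop)
open import Data.List.Properties
  using (length-take; length-drop; take++drop≡id; drop-drop; take-drop)
open import Data.List.Relation.Unary.All using (All)
open import Data.Product using (_×_; _,_; ∃-syntax)
open import Data.Sum using (_⊎_; inj₁; inj₂; [_,_]′)
open import Data.Empty using (⊥-elim)
open import Function using (_∘_)
open import Relation.Binary using (IsStrictTotalOrder; tri<; tri≈; tri>)
open import Relation.Binary.PropositionalEquality
  using (_≡_; _≢_; refl; sym; trans; cong; cong₂; subst; subst₂; module ≡-Reasoning)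
open import Relation.Nullary using (¬_; yes; no)

m<m+n⇒0<n : ∀ {m n} → m < m + n → 0 < n
m<m+n⇒0<n {m} {n} m<m+n = +-cancelˡ-< m 0 n (subst (_< m + n) (sym (+-identityʳ m)) m<m+n)

module _ {A : Set} where

  drop-++ˡ : ∀ k (xs ys : List A) → k ≤ length xs → drop k (xs ++ ys) ≡ drop k xs ++ ys
  drop-++ˡ zero    xs       ys _         = refl
  drop-++ˡ (suc k) (x ∷ xs) ys (s≤s k≤) = drop-++ˡ k xs ys k≤

  drop-length-++ : ∀ (xs ys : List A) → drop (length xs) (xs ++ ys) ≡ ys
  drop-length-++ []       ys = refl
  drop-length-++ (x ∷ xs) ys = drop-length-++ xs ys

module Lex {A : Set} {_⊏_ : A → A → Set} where
  open Strings _⊏_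

  ≺-++⁺ : ∀ {x y} r s → x ≺ y → length y ≤ length x → (x ++ r) ≺ (y ++ s)
  ≺-++⁺ r s (head≺ p) _         = head≺ p
  ≺-++⁺ r s (tail≺ p) (s≤s y≤x) = tail≺ (≺-++⁺ r s p y≤x)

  ≺-++⁻ : ∀ x u z → x ≺ (u ++ z) →
          (∀ L → length u ≤ L → take L x ≺ u) ⊎ (∃[ x′ ] (x ≡ u ++ x′ × x′ ≺ z))
  ≺-++⁻ x       []      z x≺z       = inj₂ (x , refl , x≺z)
  ≺-++⁻ []      (c ∷ u) z _         = inj₁ λ { zero _ → []≺∷ ; (suc L) _ → []≺∷ }
  ≺-++⁻ (a ∷ x) (c ∷ u) z (head≺ p) = inj₁ λ { (suc L) _ → head≺ p }
  ≺-++⁻ (a ∷ x) (a ∷ u) z (tail≺ p) with ≺-++⁻ x u z p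
  ... | inj₁ prefix≺           = inj₁ λ { (suc L) (s≤s u≤L) → tail≺ (prefix≺ L u≤L) }
  ... | inj₂ (x′ , refl , x′≺z) = inj₂ (x′ , refl , x′≺z)

  IsLyndon⇒++≺drop++ : ∀ {α} r {k} → IsLyndon α → 0 < k → k < length α →
                       (α ++ r) ≺ (drop k α ++ r)
  IsLyndon⇒++≺drop++ {α} r {k} (_ , α≺suffixes) 0<k k<|α| =
    ≺-++⁺ r r (α≺suffixes k 0<k k<|α|)
          (subst (_≤ length α) (sym (length-drop k α)) (m∸n≤m (length α) k))

module LexOrder {A : Set} {_⊏_ : A → A → Set} (sto : IsStrictTotalOrder _≡_ _⊏_) where
  open Strings _⊏_
  open IsStrictTotalOrder sto using (compare) renaming (trans to ⊏-trans; irrefl to ⊏-irrefl)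

  ≺-trans : ∀ {x y z} → x ≺ y → y ≺ z → x ≺ z
  ≺-trans []≺∷       (head≺ _) = []≺∷
  ≺-trans []≺∷       (tail≺ _) = []≺∷
  ≺-trans (head≺ p) (head≺ q) = head≺ (⊏-trans p q)
  ≺-trans (head≺ p) (tail≺ _) = head≺ p
  ≺-trans (tail≺ _) (head≺ q) = head≺ q
  ≺-trans (tail≺ p) (tail≺ q) = tail≺ (≺-trans p q)

  ≺-irrefl : ∀ {x} → ¬ x ≺ x
  ≺-irrefl (head≺ p) = ⊏-irrefl refl p
  ≺-irrefl (tail≺ p) = ≺-irrefl p

  ≺-asym : ∀ {x y} → x ≺ y → ¬ y ≺ x
  ≺-asym p q = ≺-irrefl (≺-trans p q)

  ⊀∧≢⇒≺ : ∀ x y → ¬ y ≺ x → x ≢ y → x ≺ y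
  ⊀∧≢⇒≺ []       []       _    x≢y = ⊥-elim (x≢y refl)
  ⊀∧≢⇒≺ []       (b ∷ y)  _    _   = []≺∷
  ⊀∧≢⇒≺ (a ∷ x)  []       y⊀x  _   = ⊥-elim (y⊀x []≺∷)
  ⊀∧≢⇒≺ (a ∷ x)  (b ∷ y)  y⊀x  x≢y with compare a b
  ... | tri< a⊏b _ _ = head≺ a⊏b
  ... | tri> _ _ b⊏a = ⊥-elim (y⊀x (head≺ b⊏a))
  ... | tri≈ _ refl _ = tail≺ (⊀∧≢⇒≺ x y (y⊀x ∘ tail≺) (x≢y ∘ cong (a ∷_)))

module Suffixes {A : Set} {_⊏_ : A → A → Set} (sto : IsStrictTotalOrder _≡_ _⊏_) (S : List A) where
  open Strings _⊏_
  open OnString S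
  open Lex
  open LexOrder sto
  open ≡-Reasoning

  drop-Suf : ∀ j k → drop k (Suf j) ≡ Suf (j + k)
  drop-Suf j k = drop-drop j k S

  Suf-take++Suf : ∀ j k → Suf j ≡ take k (Suf j) ++ Suf (j + k)
  Suf-take++Suf j k = trans (sym (take++drop≡id k (Suf j))) (cong (take k (Suf j) ++_) (drop-Suf j k))

  ≤-length-Suf : ∀ {j k} → j + k ≤ n → k ≤ length (Suf j)
  ≤-length-Suf {j} {k} j+k≤n =
    subst (k ≤_) (sym (length-drop j S)) (m+n≤o⇒m≤o∸n k (subst (_≤ n) (+-comm j k) j+k≤n))

  length-take-Suf : ∀ {j k} → j + k ≤ n → length (take k (Suf j)) ≡ k
  length-take-Suf {j} {k} j+k≤n = trans (length-take k (Suf j)) (m≤n⇒m⊓n≡m (≤-length-Suf j+k≤n))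

  Suf-injective : ∀ {j k} → j ≤ n → k ≤ n → Suf j ≡ Suf k → j ≡ k
  Suf-injective {j} {k} j≤n k≤n eq =
    ∸-cancelˡ-≡ j≤n k≤n (trans (sym (length-drop j S)) (trans (cong length eq) (length-drop k S)))

  Nss⇒≺-between : ∀ {j i k} → Nss j i → j < k → k < i → Suf j ≺ Suf k
  Nss⇒≺-between {j} {i} {k} (_ , i≤n , _ , notBelow) j<k k<i =
    ⊀∧≢⇒≺ (Suf j) (Suf k) (notBelow k j<k k<i)
          (<⇒≢ j<k ∘ Suf-injective (≤-trans (<⇒≤ j<k) k≤n) k≤n)
    where k≤n = ≤-trans (<⇒≤ k<i) i≤n

  Nss⇒context-fits : ∀ {j i α} → Nss j i → IsLyndon α → Suf j ≡ α ++ Suf (j + length α) →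
                     j + length α ≤ i
  Nss⇒context-fits {j} {i} {α} (j<i , _ , i≺j , _) lyn factor with j + length α ≤? i
  ... | yes fits = fits
  ... | no ¬fits with m≤n⇒∃[o]m+o≡n (<⇒≤ j<i)
  ...   | k , refl = ⊥-elim (≺-asym i≺j j≺j+k)
    where
    r = Suf (j + length α)
    0<k : 0 < k
    0<k = m<m+n⇒0<n j<i
    k<|α| : k < length α
    k<|α| = +-cancelˡ-< j k (length α) (≰⇒> ¬fits)
    Suf-j+k : Suf (j + k) ≡ drop k α ++ r
    Suf-j+k = begin
      Suf (j + k)          ≡⟨ drop-Suf j k ⟨
      drop k (Suf j)       ≡⟨ cong (drop k) factor ⟩
      drop k (α ++ r)      ≡⟨ drop-++ˡ k α r (<⇒≤ k<|α|) ⟩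
      drop k α ++ r        ∎
    j≺j+k : Suf j ≺ Suf (j + k)
    j≺j+k = subst₂ _≺_ (sym factor) (sym Suf-j+k) (IsLyndon⇒++≺drop++ r lyn 0<k k<|α|)

  Nss⇒take≺take : ∀ {j k M} → Nss j (j + (k + M)) → 0 < k → 0 < M →
                  take (k + M) (Suf j) ≺ take M (Suf (j + k))
  Nss⇒take≺take {j} {k} {M} nss@(_ , i≤n , i≺j , notBelow) 0<k 0<M =
    [ prefix-case , extension-case ]′ (≺-++⁻ (Suf j) u (Suf i) j≺u++i)
    where
    i = j + (k + M)
    u = take M (Suf (j + k))
    |u|≡M : length u ≡ M
    |u|≡M = length-take-Suf (subst (_≤ n) (sym (+-assoc j k M)) i≤n)
    j≺u++i : Suf j ≺ (u ++ Suf i)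
    j≺u++i = subst (Suf j ≺_)
      (trans (Suf-take++Suf (j + k) M) (cong (λ t → u ++ Suf t) (+-assoc j k M)))
      (Nss⇒≺-between nss (m<m+n j 0<k) (+-monoʳ-< j (m<m+n k 0<M)))
    prefix-case : (∀ L → length u ≤ L → take L (Suf j) ≺ u) → take (k + M) (Suf j) ≺ u
    prefix-case take≺u = take≺u (k + M) (subst (_≤ k + M) (sym |u|≡M) (m≤n+m M k))
    extension-case : ∃[ x′ ] (Suf j ≡ u ++ x′ × x′ ≺ Suf i) → take (k + M) (Suf j) ≺ u
    extension-case (x′ , j≡u++x′ , x′≺i) =
      ⊥-elim (notBelow (j + M) (m<m+n j 0<M) (+-monoʳ-< j (m<n+m M 0<k))
                       (subst (_≺ Suf j) x′≡Suf-j+M (≺-trans x′≺i i≺j)))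
      where
      x′≡Suf-j+M : x′ ≡ Suf (j + M)
      x′≡Suf-j+M = begin
        x′                          ≡⟨ drop-length-++ u x′ ⟨
        drop (length u) (u ++ x′)   ≡⟨ cong₂ drop (sym |u|≡M) j≡u++x′ ⟨
        drop M (Suf j)              ≡⟨ drop-Suf j M ⟩
        Suf (j + M)                 ∎

  Nss⇒take-IsLyndon : ∀ {j L} → Nss j (j + L) → IsLyndon (take L (Suf j))
  Nss⇒take-IsLyndon {j} {L} nss@(j<j+L , j+L≤n , _) =
    subst (0 <_) (sym |w|≡L) 0<L , w≺drop
    where
    w = take L (Suf j)
    |w|≡L : length w ≡ L
    |w|≡L = length-take-Suf j+L≤n
    0<L : 0 < L
    0<L = m<m+n⇒0<n j<j+L
    w≺drop : ∀ k → 0 < k → k < length w → w ≺ drop k w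
    w≺drop k 0<k k<|w| with m≤n⇒∃[o]m+o≡n (<⇒≤ (subst (k <_) |w|≡L k<|w|))
    ... | M , refl = subst (w ≺_) drop-w (Nss⇒take≺take nss 0<k 0<M)
      where
      0<M : 0 < M
      0<M = m<m+n⇒0<n (subst (k <_) |w|≡L k<|w|)
      drop-w : take M (Suf (j + k)) ≡ drop k w
      drop-w = trans (cong (take M) (sym (drop-Suf j k))) (take-drop M k (Suf j))

  Nss-shared⇒¬IsLongestLyndonPrefix :
    ∀ {j j′ i α} → j < j′ → Nss j i → Nss j′ i → IsLyndon α →
    Suf j′ ≡ α ++ Suf (j′ + length α) → ¬ IsLongestLyndonPrefix α (Suf j)
  Nss-shared⇒¬IsLongestLyndonPrefix {j} {α = α} j<j′ nss@(j<i , i≤n , _) nss′ lyn factor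
    (_ , _ , _ , longest) with m≤n⇒∃[o]m+o≡n (<⇒≤ j<i)
  ... | L , refl = longest L |α|<L (≤-length-Suf i≤n) (Nss⇒take-IsLyndon nss)
    where
    |α|<L : length α < L
    |α|<L = +-cancelˡ-< j (length α) L
      (<-≤-trans (+-monoˡ-< (length α) j<j′) (Nss⇒context-fits nss′ lyn factor))

  Nss-shared-Lyndon-context⇒≡ :
    ∀ {j₁ j₂ i α} → Nss j₁ i → Nss j₂ i → IsLyndon α →
    Suf j₁ ≡ α ++ Suf (j₁ + length α) → Suf j₂ ≡ α ++ Suf (j₂ + length α) →
    IsLongestLyndonPrefix α (Suf j₁) → IsLongestLyndonPrefix α (Suf j₂) → j₁ ≡ j₂
  Nss-shared-Lyndon-context⇒≡ {j₁} {j₂} nss₁ nss₂ lyn factor₁ factor₂ longest₁ longest₂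
    with <-cmp j₁ j₂
  ... | tri< j₁<j₂ _ _ = ⊥-elim (Nss-shared⇒¬IsLongestLyndonPrefix j₁<j₂ nss₁ nss₂ lyn factor₂ longest₁)
  ... | tri≈ _ j₁≡j₂ _ = j₁≡j₂
  ... | tri> _ _ j₂<j₁ = ⊥-elim (Nss-shared⇒¬IsLongestLyndonPrefix j₂<j₁ nss₂ nss₁ lyn factor₁ longest₂)

corollary1 : (A : Set) (_⊏_ : A → A → Set) → IsStrictTotalOrder _≡_ _⊏_ →
    (w : List A) (dollar : A) → All (dollar ⊏_) w →
    let S = w ++ (dollar ∷ []) in
    let open Strings _⊏_ in
    let open OnString S in
    1 < n →
    (SA : ℕ → ℕ) → IsSuffixArray SA →
    let open WithSA SA in
    (m : ℕ) (G : ℕ → Group) → IsLyndonGrouping m G →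
    ∀ i → i ≤ n →
    ∀ j₁ j₂ → InP i j₁ → InP i j₂ → ¬ (j₁ ≡ j₂) →
    ∀ a b → 1 ≤ a → a ≤ m → 1 ≤ b → b ≤ m →
    ElemOf j₁ (G a) → ElemOf j₂ (G b) → ¬ (a ≡ b)
corollary1 _ _ sto w dollar _ _ _ _ _ _ (_ , lyndonGroup) _ _ j₁ j₂ (_ , nss₁) (_ , nss₂) j₁≢j₂
           a _ 1≤a a≤m _ _ j₁∈Ga j₂∈Ga refl
  with lyndonGroup a 1≤a a≤m
... | (_ , _ , lyn , factor) , longest =
  j₁≢j₂ (Suffixes.Nss-shared-Lyndon-context⇒≡ sto (w ++ dollar ∷ []) nss₁ nss₂ lyn
           (factor j₁ j₁∈Ga) (factor j₂ j₂∈Ga) (longest j₁ j₁∈Ga) (longest j₂ j₂∈Ga))
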